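{- For every reduced $n$-expression $u$ of length $\ell$, $\operatorname{dist}(u,\mathrm{NF}(u)) \le n(n-1)\ell/2$.
   Context: For $1\le i\le n-1$, $\sigma_i$ is the transposition exchanging $i$ and $i+1$. An $n$-expression is a word over $\{\sigma_1,\dots,\sigma_{n-1}\}$, representing the product of its letters read left to right; equivalent means representing the same permutation; reduced means no shorter equivalent expression exists. Braid relations: (I) $\sigma_i\sigma_j\sigma_i=\sigma_j\sigma_i\sigma_j$ for $|i-j|=1$; (II) $\sigma_i\sigma_j=\sigma_j\sigma_i$ for $|i-j|\ge2$. For equivalent reduced $u,v$, $\operatorname{dist}(u,v)$ is the minimal number of braid-relation applications transforming $u$ into $v$. For $j>i$, $\sigma_{j,i}=\sigma_{j-1}\cdots\sigma_i$, and $\sigma_{i,i}$ is empty. A normal $n$-expression is one of the form $\sigma_{1,f(1)}\sigma_{2,f(2)}\cdots\sigma_{n,f(n)}$ with $f(i)\le i$ for all $i$; every permutation has a unique normal $n$-expression, and $\mathrm{NF}(u)$ denotes the normal $n$-expression equivalent to $u$. -}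

module Defs where

open import Data.Nat using (ℕ; zero; suc; _+_; _*_; _∸_; _≤_; _<_; _≤?_; _≟_)
open import Data.List using (List; []; _∷_; _++_; length)
open import Data.List.Relation.Unary.All using (All)
open import Data.Product using (_×_; ∃; ∃-syntax; Σ)
open import Data.Sum using (_⊎_)
open import Relation.Binary.PropositionalEquality using (_≡_)
open import Relation.Nullary using (yes; no)

-- A word: list of indices i, the letter i standing for σ_i.
Word : Set
Word = List ℕ

IsExpr : ℕ → Word → Set
IsExpr n u = All (λ i → 1 ≤ i × suc i ≤ n) u

swap : ℕ → ℕ → ℕ
swap i k with k ≟ i
... | yes _ = suc i
... | no _ with k ≟ suc i
...   | yes _ = i
...   | no _ = k

eval : Word → ℕ → ℕ
eval [] k = k
eval (i ∷ w) k = eval w (swap i k)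

Equiv : Word → Word → Set
Equiv u v = ∀ k → eval u k ≡ eval v k

Reduced : ℕ → Word → Set
Reduced n u = IsExpr n u × (∀ v → IsExpr n v → Equiv u v → length u ≤ length v)

data BraidStep : Word → Word → Set where
  braidI  : ∀ p s i j → (suc i ≡ j ⊎ suc j ≡ i) →
            BraidStep (p ++ (i ∷ j ∷ i ∷ []) ++ s) (p ++ (j ∷ i ∷ j ∷ []) ++ s)
  braidII : ∀ p s i j → (2 + i ≤ j ⊎ 2 + j ≤ i) →
            BraidStep (p ++ (i ∷ j ∷ []) ++ s) (p ++ (j ∷ i ∷ []) ++ s)

data BraidPath : ℕ → Word → Word → Set where
  done : ∀ {u} → BraidPath 0 u u
  step : ∀ {k u v w} → BraidStep u v → BraidPath k v w → BraidPath (suc k) u w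

-- dist(u,v) ≤ d  iff  some chain of at most d braid applications links u to v
DistLe : Word → Word → ℕ → Set
DistLe u v d = ∃[ k ] (k ≤ d × BraidPath k u v)

-- σ_{j,i} = σ_{j-1} ⋯ σ_i  (empty when j ≤ i)
sigma : ℕ → ℕ → Word
sigma zero i = []
sigma (suc j) i with i ≤? j
... | yes _ = j ∷ sigma j i
... | no _ = []

-- σ_{1,f(1)} σ_{2,f(2)} ⋯ σ_{m,f(m)}
normalExpr : (ℕ → ℕ) → ℕ → Word
normalExpr f zero = []
normalExpr f (suc m) = normalExpr f m ++ sigma (suc m) (f (suc m))

NormalIndex : ℕ → (ℕ → ℕ) → Set
NormalIndex n f = ∀ i → 1 ≤ i → i ≤ n → 1 ≤ f i × f i ≤ i

{-# OPTIONS --safe #-}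
module Submission where

-- A normal expression is a product of blocks;
-- appending σ_k (k ≤ m) after the block B = σ_{m+1,c} = σ_m ⋯ σ_c costs at most m braid moves,
-- after which σ_k or σ_{k-1} is appended to the shorter normal expression in front of B:
--   c > k+1: σ_k commutes past every letter of B;
--   c = k+1: B σ_k = σ_{m+1,k} is itself a block, and nothing is handed on;
--   c < k:   B = U σ_k σ_{k-1} W with U = σ_{m+1,k+1} and W = σ_{k-1,c}; σ_k commutes past W,
--            σ_k σ_{k-1} σ_k becomes σ_{k-1} σ_k σ_{k-1}, and σ_{k-1} commutes past U;
--   c = k:   B σ_k = σ_{m+1,k+1} is two letters shorter, which is impossible in a reduced word.
-- So one letter costs at most (n-1) + (n-2) + ⋯ + 1 = n(n-1)/2 moves.

open import Defs
open import Function using (id)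
open import Data.Nat using (ℕ; zero; suc; _+_; _*_; _∸_; _≤_; _<_; _/_; _≟_; _≤?_; z≤n; s≤s)
open import Data.Nat.Properties
open import Data.Nat.DivMod using (m*n/n≡m)
open import Data.Nat.Combinatorics using (_C_; nC1≡n; nCk+nC[k+1]≡[n+1]C[k+1])
open import Data.List using ([]; _∷_; _++_; _∷ʳ_; [_]; length)
open import Data.List.Properties using (++-assoc; length-++; ++-identityʳ)
open import Data.List.Relation.Unary.All as All using (All; []; _∷_)
open import Data.List.Relation.Unary.All.Properties using (++⁺; ++⁻ˡ; ++⁻ʳ)
open import Data.List.Reverse using (Reverse; []; _∶_∶ʳ_; reverseView)
open import Data.Product using (_×_; ∃-syntax; _,_; proj₁)
open import Data.Sum using (_⊎_; inj₁; inj₂)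
open import Relation.Nullary using (yes; no; contradiction)
open import Relation.Binary using (tri<; tri≈; tri>)
open import Relation.Binary.PropositionalEquality hiding ([_])

private
  variable
    a b c d i j k m n : ℕ
    u u′ v v′ w : Word

swap-self : ∀ i → swap i i ≡ suc i
swap-self i with i ≟ i
... | yes _ = refl
... | no i≢i = contradiction refl i≢i

swap-suc : ∀ i → swap i (suc i) ≡ i
swap-suc i with suc i ≟ i
... | yes 1+i≡i = contradiction 1+i≡i (≢-sym (<⇒≢ (n<1+n i)))
... | no _ with suc i ≟ suc i
...   | yes _ = refl
...   | no 1+i≢1+i = contradiction refl 1+i≢1+i

swap-fix : k ≢ i → k ≢ suc i → swap i k ≡ k
swap-fix {k} {i} k≢i k≢1+i with k ≟ i
... | yes k≡i = contradiction k≡i k≢i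
... | no _ with k ≟ suc i
...   | yes k≡1+i = contradiction k≡1+i k≢1+i
...   | no _ = refl

swap-involutive : ∀ i k → swap i (swap i k) ≡ k
swap-involutive i k with k ≟ i
... | yes refl = swap-suc i
... | no k≢i with k ≟ suc i
...   | yes refl = swap-self i
...   | no k≢1+i = swap-fix k≢i k≢1+i

swap-fix-< : k < i → swap i k ≡ k
swap-fix-< k<i = swap-fix (<⇒≢ k<i) (<⇒≢ (m<n⇒m<1+n k<i))

swap-fix-> : suc i < k → swap i k ≡ k
swap-fix-> 1+i<k = swap-fix (≢-sym (<⇒≢ (<-trans (n<1+n _) 1+i<k))) (≢-sym (<⇒≢ 1+i<k))

swap-≤ : k ≤ suc i → swap i k ≤ suc i
swap-≤ {k} {i} k≤1+i with k ≟ i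
... | yes _ = ≤-refl
... | no _ with k ≟ suc i
...   | yes _ = n≤1+n i
...   | no _ = k≤1+i

swap-≥ : j ≤ i → j ≤ k → j ≤ swap i k
swap-≥ {j} {i} {k} j≤i j≤k with k ≟ i
... | yes _ = m≤n⇒m≤1+n j≤i
... | no _ with k ≟ suc i
...   | yes _ = j≤i
...   | no _ = j≤k

swap-braid : ∀ i k → swap i (swap (suc i) (swap i k)) ≡ swap (suc i) (swap i (swap (suc i) k))
swap-braid i k with k ≟ i
... | yes refl
  rewrite swap-self (suc i) | swap-fix-> {i} (n<1+n (suc i))
        | swap-fix-< (n<1+n i) | swap-self i | swap-self (suc i) = refl
... | no k≢i with k ≟ suc i
...   | yes refl
  rewrite swap-fix-< (n<1+n i) | swap-self i
        | swap-fix-> {i} (n<1+n (suc i)) | swap-suc (suc i) = refl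
...   | no k≢1+i with k ≟ suc (suc i)
...     | yes refl
  rewrite swap-suc (suc i) | swap-suc i | swap-fix-< (n<1+n i) = refl
...     | no k≢2+i
  rewrite swap-fix k≢i k≢1+i | swap-fix k≢1+i k≢2+i | swap-fix k≢i k≢1+i = refl

swap-comm : 2 + i ≤ j → ∀ k → swap i (swap j k) ≡ swap j (swap i k)
swap-comm {i} {j} 2+i≤j k with k ≤? suc i
... | yes k≤1+i
  rewrite swap-fix-< {k} {j} (≤-trans (s≤s k≤1+i) 2+i≤j)
        | swap-fix-< {swap i k} {j} (≤-trans (s≤s (swap-≤ k≤1+i)) 2+i≤j) = refl
... | no k≰1+i
  rewrite swap-fix-> {i} {k} (≰⇒> k≰1+i)
        | swap-fix-> {i} {swap j k} (swap-≥ 2+i≤j (≰⇒> k≰1+i)) = refl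

eval-++ : ∀ u v k → eval (u ++ v) k ≡ eval v (eval u k)
eval-++ []      v k = refl
eval-++ (i ∷ u) v k = eval-++ u v (swap i k)

equiv-++ˡ : ∀ p → Equiv u v → Equiv (p ++ u) (p ++ v)
equiv-++ˡ {u} {v} p u≈v k = begin
  eval (p ++ u) k   ≡⟨ eval-++ p u k ⟩
  eval u (eval p k) ≡⟨ u≈v (eval p k) ⟩
  eval v (eval p k) ≡⟨ eval-++ p v k ⟨
  eval (p ++ v) k   ∎
  where open ≡-Reasoning

equiv-++ʳ : ∀ s → Equiv u v → Equiv (u ++ s) (v ++ s)
equiv-++ʳ {u} {v} s u≈v k = begin
  eval (u ++ s) k   ≡⟨ eval-++ u s k ⟩
  eval s (eval u k) ≡⟨ cong (eval s) (u≈v k) ⟩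
  eval s (eval v k) ≡⟨ eval-++ v s k ⟨
  eval (v ++ s) k   ∎
  where open ≡-Reasoning

length-∷ʳ : ∀ (w : Word) i → length (w ∷ʳ i) ≡ suc (length w)
length-∷ʳ w i = trans (length-++ w) (+-comm (length w) 1)

equiv-∷ʳ-∷ʳ : ∀ w i → Equiv (w ∷ʳ i ∷ʳ i) w
equiv-∷ʳ-∷ʳ w i k = begin
  eval (w ∷ʳ i ∷ʳ i) k        ≡⟨ eval-++ (w ∷ʳ i) [ i ] k ⟩
  swap i (eval (w ∷ʳ i) k)    ≡⟨ cong (swap i) (eval-++ w [ i ] k) ⟩
  swap i (swap i (eval w k))  ≡⟨ swap-involutive i (eval w k) ⟩
  eval w k                    ∎
  where open ≡-Reasoning

equiv-braidI : suc i ≡ j ⊎ suc j ≡ i → Equiv (i ∷ j ∷ i ∷ []) (j ∷ i ∷ j ∷ [])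
equiv-braidI (inj₁ refl) k = swap-braid _ k
equiv-braidI (inj₂ refl) k = sym (swap-braid _ k)

Far : ℕ → ℕ → Set
Far i j = 2 + i ≤ j ⊎ 2 + j ≤ i

Far-sym : Far i j → Far j i
Far-sym (inj₁ 2+i≤j) = inj₂ 2+i≤j
Far-sym (inj₂ 2+j≤i) = inj₁ 2+j≤i

equiv-braidII : Far i j → Equiv (i ∷ j ∷ []) (j ∷ i ∷ [])
equiv-braidII (inj₁ 2+i≤j) k = sym (swap-comm 2+i≤j k)
equiv-braidII (inj₂ 2+j≤i) k = swap-comm 2+j≤i k

braidStep-sound : BraidStep u v → Equiv u v
braidStep-sound (braidI p s i j adj) =
  equiv-++ˡ p (equiv-++ʳ {i ∷ j ∷ i ∷ []} {j ∷ i ∷ j ∷ []} s (equiv-braidI adj))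
braidStep-sound (braidII p s i j far) =
  equiv-++ˡ p (equiv-++ʳ {i ∷ j ∷ []} {j ∷ i ∷ []} s (equiv-braidII far))

braidStep-length : BraidStep u v → length u ≡ length v
braidStep-length (braidI p _ _ _ _) = trans (length-++ p) (sym (length-++ p))
braidStep-length (braidII p _ _ _ _) = trans (length-++ p) (sym (length-++ p))

braidPath-sound : BraidPath d u v → Equiv u v
braidPath-sound done k = refl
braidPath-sound (step s p) k = trans (braidStep-sound s k) (braidPath-sound p k)

braidPath-length : BraidPath d u v → length u ≡ length v
braidPath-length done = refl
braidPath-length (step s p) = trans (braidStep-length s) (braidPath-length p)

distLe-sound : DistLe u v d → Equiv u v
distLe-sound (_ , _ , path) = braidPath-sound path

distLe-length : DistLe u v d → length u ≡ length v
distLe-length (_ , _ , path) = braidPath-length path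

distLe-refl : DistLe u u 0
distLe-refl = 0 , z≤n , done

braidPath-trans : BraidPath a u v → BraidPath b v w → BraidPath (a + b) u w
braidPath-trans done q = q
braidPath-trans (step s p) q = step s (braidPath-trans p q)

distLe-trans : DistLe u v a → DistLe v w b → DistLe u w (a + b)
distLe-trans (k , k≤a , p) (l , l≤b , q) = k + l , +-mono-≤ k≤a l≤b , braidPath-trans p q

distLe-mono : a ≤ b → DistLe u v a → DistLe u v b
distLe-mono a≤b (k , k≤a , p) = k , ≤-trans k≤a a≤b , p

distLe-step : BraidStep u v → DistLe u v 1
distLe-step s = 1 , ≤-refl , step s done

distLe-resp : u ≡ u′ → v ≡ v′ → DistLe u v d → DistLe u′ v′ d
distLe-resp refl refl uv = uv

braidStep-++ˡ : ∀ t → BraidStep u v → BraidStep (t ++ u) (t ++ v)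
braidStep-++ˡ t (braidI p s i j adj) =
  subst₂ BraidStep (++-assoc t p _) (++-assoc t p _) (braidI (t ++ p) s i j adj)
braidStep-++ˡ t (braidII p s i j far) =
  subst₂ BraidStep (++-assoc t p _) (++-assoc t p _) (braidII (t ++ p) s i j far)

braidStep-++ʳ : ∀ t → BraidStep u v → BraidStep (u ++ t) (v ++ t)
braidStep-++ʳ t (braidI p s i j adj) =
  subst₂ BraidStep (sym (++-assoc p _ t)) (sym (++-assoc p _ t)) (braidI p (s ++ t) i j adj)
braidStep-++ʳ t (braidII p s i j far) =
  subst₂ BraidStep (sym (++-assoc p _ t)) (sym (++-assoc p _ t)) (braidII p (s ++ t) i j far)

braidPath-++ˡ : ∀ t → BraidPath d u v → BraidPath d (t ++ u) (t ++ v)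
braidPath-++ˡ t done = done
braidPath-++ˡ t (step s p) = step (braidStep-++ˡ t s) (braidPath-++ˡ t p)

braidPath-++ʳ : ∀ t → BraidPath d u v → BraidPath d (u ++ t) (v ++ t)
braidPath-++ʳ t done = done
braidPath-++ʳ t (step s p) = step (braidStep-++ʳ t s) (braidPath-++ʳ t p)

distLe-++ˡ : ∀ t → DistLe u v d → DistLe (t ++ u) (t ++ v) d
distLe-++ˡ t (k , k≤d , p) = k , k≤d , braidPath-++ˡ t p

distLe-++ʳ : ∀ t → DistLe u v d → DistLe (u ++ t) (v ++ t) d
distLe-++ʳ t (k , k≤d , p) = k , k≤d , braidPath-++ʳ t p

-- The descending blocks σ_{j,i}

sigma-self : ∀ j → sigma j j ≡ []
sigma-self zero = refl
sigma-self (suc j) with suc j ≤? j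
... | yes 1+j≤j = contradiction 1+j≤j (1+n≰n)
... | no _ = refl

sigma-suc : i ≤ j → sigma (suc j) i ≡ j ∷ sigma j i
sigma-suc {i} {j} i≤j with i ≤? j
... | yes _ = refl
... | no i≰j = contradiction i≤j i≰j

sigma-++ : ∀ {i t j} → i ≤ t → t ≤ j → sigma j i ≡ sigma j t ++ sigma t i
sigma-++ {j = zero} z≤n z≤n = refl
sigma-++ {i} {t} {suc j} i≤t t≤1+j with t ≤? j
... | yes t≤j rewrite sigma-suc (≤-trans i≤t t≤j) = cong (j ∷_) (sigma-++ i≤t t≤j)
... | no t≰j rewrite ≤-antisym t≤1+j (≰⇒> t≰j) = refl

sigma-∷ʳ : i < j → sigma j i ≡ sigma j (suc i) ∷ʳ i
sigma-∷ʳ {i} i<j rewrite sigma-++ (n≤1+n i) i<j | sigma-suc {i} ≤-refl | sigma-self i = refl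

length-sigma : ∀ j i → length (sigma j i) ≤ j ∸ i
length-sigma zero i = z≤n
length-sigma (suc j) i with i ≤? j
... | yes i≤j = ≤-trans (s≤s (length-sigma j i)) (≤-reflexive (sym (+-∸-assoc 1 i≤j)))
... | no _ = z≤n

All-sigma : ∀ j i → All (λ x → i ≤ x × x < j) (sigma j i)
All-sigma zero i = []
All-sigma (suc j) i with i ≤? j
... | yes i≤j = (i≤j , n<1+n j) ∷ All.map (λ (i≤x , x<j) → i≤x , m<n⇒m<1+n x<j) (All-sigma j i)
... | no _ = []

setAt : (ℕ → ℕ) → ℕ → ℕ → ℕ → ℕ
setAt f j c i with i ≟ j
... | yes _ = c
... | no _ = f i

setAt-self : ∀ f j c → setAt f j c j ≡ c
setAt-self f j c with j ≟ j
... | yes _ = refl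
... | no j≢j = contradiction refl j≢j

setAt-other : ∀ f j c → i ≢ j → setAt f j c i ≡ f i
setAt-other {i} f j c i≢j with i ≟ j
... | yes i≡j = contradiction i≡j i≢j
... | no _ = refl

normalExpr-cong : ∀ {f g} m → (∀ i → i ≤ m → f i ≡ g i) → normalExpr f m ≡ normalExpr g m
normalExpr-cong zero f≗g = refl
normalExpr-cong {f} {g} (suc m) f≗g =
  cong₂ (λ w c → w ++ sigma (suc m) c)
    (normalExpr-cong m (λ i i≤m → f≗g i (m≤n⇒m≤1+n i≤m))) (f≗g (suc m) ≤-refl)

normalExpr-setAt : ∀ f m c → normalExpr (setAt f (suc m) c) (suc m) ≡ normalExpr f m ++ sigma (suc m) c
normalExpr-setAt f m c =
  cong₂ (λ w c → w ++ sigma (suc m) c)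
    (normalExpr-cong m (λ i i≤m → setAt-other f (suc m) c (<⇒≢ (s≤s i≤m))))
    (setAt-self f (suc m) c)

normalExpr-id : ∀ m → normalExpr id m ≡ []
normalExpr-id zero = refl
normalExpr-id (suc m) rewrite normalExpr-id m = sigma-self (suc m)

NormalIndex-id : ∀ n → NormalIndex n id
NormalIndex-id n i 1≤i _ = 1≤i , ≤-refl

NormalIndex-pred : ∀ {f} → NormalIndex (suc m) f → NormalIndex m f
NormalIndex-pred f-normal i 1≤i i≤m = f-normal i 1≤i (m≤n⇒m≤1+n i≤m)

NormalIndex-setAt : ∀ {f} → NormalIndex m f → 1 ≤ c → c ≤ suc m →
                    NormalIndex (suc m) (setAt f (suc m) c)
NormalIndex-setAt {m} {c} {f} f-normal 1≤c c≤1+m i 1≤i i≤1+m with i ≟ suc m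
... | yes refl = 1≤c , c≤1+m
... | no i≢1+m = f-normal i 1≤i (≤-pred (≤∧≢⇒< i≤1+m i≢1+m))

normalExpr-isExpr : ∀ {f} → NormalIndex n f → m ≤ n → IsExpr n (normalExpr f m)
normalExpr-isExpr {m = zero} f-normal _ = []
normalExpr-isExpr {n} {suc m} {f} f-normal 1+m≤n =
  ++⁺ (normalExpr-isExpr f-normal (≤-trans (n≤1+n m) 1+m≤n))
      (All.map (λ (c≤x , x<1+m) → ≤-trans 1≤c c≤x , ≤-trans x<1+m 1+m≤n)
               (All-sigma (suc m) (f (suc m))))
  where 1≤c = proj₁ (f-normal (suc m) (s≤s z≤n) 1+m≤n)

-- Moving a letter leftwards through a block

slide-far : ∀ k w r → All (Far k) w → DistLe (w ++ k ∷ r) (k ∷ w ++ r) (length w)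
slide-far k []      r []             = distLe-refl
slide-far k (x ∷ w) r (k-far-x ∷ ks) =
  distLe-mono (≤-reflexive (+-comm (length w) 1))
    (distLe-trans (distLe-++ˡ [ x ] (slide-far k w r ks))
                  (distLe-step (braidII [] (w ++ r) x k (Far-sym k-far-x))))

sigma-slide-far : suc (suc k) ≤ c → DistLe (sigma j c ∷ʳ k) (k ∷ sigma j c) (length (sigma j c))
sigma-slide-far {k} {c} {j} 2+k≤c =
  distLe-resp refl (cong (k ∷_) (++-identityʳ (sigma j c)))
    (slide-far k (sigma j c) [] (All.map (λ (c≤x , _) → inj₁ (≤-trans 2+k≤c c≤x)) (All-sigma j c)))

sigma-slide-braid : c ≤ k → suc (suc k) ≤ j →
                    DistLe (sigma j c ∷ʳ suc k) (k ∷ sigma j c) (length (sigma j c))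
sigma-slide-braid {c} {k} {j} c≤k 2+k≤j =
  subst (λ B → DistLe (B ∷ʳ suc k) (k ∷ B) (length B)) (sym split)
    (distLe-mono bound
      (distLe-resp (sym (++-assoc U (suc k ∷ k ∷ W) [ suc k ])) refl
        (distLe-trans pastW (distLe-trans braid pastU))))
  where
  U = sigma j (suc (suc k))
  W = sigma k c
  split : sigma j c ≡ U ++ suc k ∷ k ∷ W
  split rewrite sigma-++ (≤-trans c≤k (≤-trans (n≤1+n k) (n≤1+n (suc k)))) 2+k≤j
              | sigma-suc (m≤n⇒m≤1+n c≤k) | sigma-suc c≤k = refl
  pastW : DistLe (U ++ suc k ∷ k ∷ W ∷ʳ suc k) (U ++ suc k ∷ k ∷ suc k ∷ W) (length W)
  pastW = distLe-++ˡ U (distLe-++ˡ (suc k ∷ [ k ])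
            (distLe-resp refl (cong (suc k ∷_) (++-identityʳ W))
              (slide-far (suc k) W [] (All.map (λ (_ , x<k) → inj₂ (s≤s x<k)) (All-sigma k c)))))
  braid : DistLe (U ++ suc k ∷ k ∷ suc k ∷ W) (U ++ k ∷ suc k ∷ k ∷ W) 1
  braid = distLe-step (braidI U W (suc k) k (inj₂ refl))
  pastU : DistLe (U ++ k ∷ suc k ∷ k ∷ W) (k ∷ U ++ suc k ∷ k ∷ W) (length U)
  pastU = slide-far k U (suc k ∷ k ∷ W)
            (All.map (λ (2+k≤x , _) → inj₁ 2+k≤x) (All-sigma j (suc (suc k))))
  bound : length W + (1 + length U) ≤ length (U ++ suc k ∷ k ∷ W)
  bound = begin
    length W + (1 + length U)       ≡⟨ +-comm (length W) (1 + length U) ⟩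
    suc (length U + length W)       ≤⟨ n≤1+n _ ⟩
    suc (suc (length U + length W)) ≡⟨ cong suc (+-suc (length U) (length W)) ⟨
    suc (length U + suc (length W)) ≡⟨ +-suc (length U) (suc (length W)) ⟨
    length U + suc (suc (length W)) ≡⟨ length-++ U ⟨
    length (U ++ suc k ∷ k ∷ W)     ∎
    where open ≤-Reasoning

slide-past-prefix : ∀ p → DistLe (u ∷ʳ k) (j ∷ u) d → DistLe ((p ++ u) ∷ʳ k) ((p ∷ʳ j) ++ u) d
slide-past-prefix {u} {k} {j} p slide =
  distLe-resp (sym (++-assoc p u [ k ])) (sym (++-assoc p [ j ] u)) (distLe-++ˡ p slide)

length-sigma-suc : ∀ m → 1 ≤ c → length (sigma (suc m) c) ≤ m
length-sigma-suc {c} m 1≤c = ≤-trans (length-sigma (suc m) c) (∸-monoʳ-≤ (suc m) 1≤c)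

-- Appending a letter to a normal expression

[1+m]C2≡m+mC2 : ∀ m → suc m C 2 ≡ m + m C 2
[1+m]C2≡m+mC2 m = trans (sym (nCk+nC[k+1]≡[n+1]C[k+1] m 1)) (cong (_+ m C 2) (nC1≡n m))

-- _C_ binds more loosely than _*_, hence the parentheses around n C 2.
nC2*2≡n*[n∸1] : ∀ n → (n C 2) * 2 ≡ n * (n ∸ 1)
nC2*2≡n*[n∸1] zero = refl
nC2*2≡n*[n∸1] (suc zero) = refl
nC2*2≡n*[n∸1] (suc (suc n)) = begin
  (suc (suc n) C 2) * 2           ≡⟨ cong (_* 2) ([1+m]C2≡m+mC2 (suc n)) ⟩
  (suc n + suc n C 2) * 2         ≡⟨ *-distribʳ-+ 2 (suc n) (suc n C 2) ⟩
  suc n * 2 + (suc n C 2) * 2     ≡⟨ cong (suc n * 2 +_) (nC2*2≡n*[n∸1] (suc n)) ⟩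
  suc n * 2 + suc n * n           ≡⟨ *-distribˡ-+ (suc n) 2 n ⟨
  suc n * suc (suc n)             ≡⟨ *-comm (suc n) (suc (suc n)) ⟩
  suc (suc n) * suc n             ∎
  where open ≡-Reasoning

data Insertion (m : ℕ) (w : Word) : Set where
  normalises : ∀ g → NormalIndex m g → DistLe w (normalExpr g m) (m C 2) → Insertion m w
  shortens   : ∀ g → NormalIndex m g → Equiv w (normalExpr g m) →
               length (normalExpr g m) < length w → Insertion m w

insertion-slide : ∀ {p k′} → 1 ≤ c → c ≤ suc m →
                  DistLe (sigma (suc m) c ∷ʳ k) (k′ ∷ sigma (suc m) c) (length (sigma (suc m) c)) →
                  Insertion m (p ∷ʳ k′) → Insertion (suc m) ((p ++ sigma (suc m) c) ∷ʳ k)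
insertion-slide {c} {m} {p = p} 1≤c c≤1+m block (normalises g g-normal d) =
  normalises (setAt g (suc m) c) (NormalIndex-setAt g-normal 1≤c c≤1+m)
    (distLe-resp refl (sym (normalExpr-setAt g m c))
      (distLe-mono bound (distLe-trans (slide-past-prefix p block) (distLe-++ʳ (sigma (suc m) c) d))))
  where
  bound : length (sigma (suc m) c) + m C 2 ≤ suc m C 2
  bound = ≤-trans (+-monoˡ-≤ (m C 2) (length-sigma-suc m 1≤c)) (≤-reflexive (sym ([1+m]C2≡m+mC2 m)))
insertion-slide {c} {m} {k} {p} {k′} 1≤c c≤1+m block (shortens g g-normal p∷ʳk′≈g shorter) =
  shortens (setAt g (suc m) c) (NormalIndex-setAt g-normal 1≤c c≤1+m) equiv
    (subst (λ w → length w < length ((p ++ B) ∷ʳ k)) (sym (normalExpr-setAt g m c)) lengths)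
  where
  B = sigma (suc m) c
  slide = slide-past-prefix p block
  equiv : Equiv ((p ++ B) ∷ʳ k) (normalExpr (setAt g (suc m) c) (suc m))
  equiv x = begin
    eval ((p ++ B) ∷ʳ k) x
      ≡⟨ distLe-sound slide x ⟩
    eval ((p ∷ʳ k′) ++ B) x
      ≡⟨ equiv-++ʳ {p ∷ʳ k′} {normalExpr g m} B p∷ʳk′≈g x ⟩
    eval (normalExpr g m ++ B) x
      ≡⟨ cong (λ w → eval w x) (normalExpr-setAt g m c) ⟨
    eval (normalExpr (setAt g (suc m) c) (suc m)) x
      ∎
    where open ≡-Reasoning
  lengths : length (normalExpr g m ++ B) < length ((p ++ B) ∷ʳ k)
  lengths = begin-strict
    length (normalExpr g m ++ B)       ≡⟨ length-++ (normalExpr g m) ⟩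
    length (normalExpr g m) + length B <⟨ +-monoˡ-< (length B) shorter ⟩
    length (p ∷ʳ k′) + length B        ≡⟨ length-++ (p ∷ʳ k′) ⟨
    length ((p ∷ʳ k′) ++ B)            ≡⟨ distLe-length slide ⟨
    length ((p ++ B) ∷ʳ k)             ∎
    where open ≤-Reasoning

insertion-square : ∀ {g} → NormalIndex m g → Insertion m (normalExpr g m ∷ʳ i ∷ʳ i)
insertion-square {m} {i} {g} g-normal =
  shortens g g-normal (equiv-∷ʳ-∷ʳ nf i)
    (subst (length nf <_) (sym (trans (length-∷ʳ (nf ∷ʳ i) i) (cong suc (length-∷ʳ nf i))))
      (m<n⇒m<1+n (n<1+n (length nf))))
  where
  nf : Word
  nf = normalExpr g m

insertion-cancel : ∀ m {f} → NormalIndex m f → 1 ≤ c → c ≤ m →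
                   Insertion (suc m) ((normalExpr f m ++ sigma (suc m) c) ∷ʳ c)
insertion-cancel {c} m {f} f-normal 1≤c c≤m =
  subst (Insertion (suc m)) word≡ (insertion-square (NormalIndex-setAt f-normal (s≤s z≤n) (s≤s c≤m)))
  where
  open ≡-Reasoning
  nf = normalExpr f m
  S = sigma (suc m) (suc c)
  word≡ : normalExpr (setAt f (suc m) (suc c)) (suc m) ∷ʳ c ∷ʳ c ≡ (nf ++ sigma (suc m) c) ∷ʳ c
  word≡ = cong (_∷ʳ c) (begin
    normalExpr (setAt f (suc m) (suc c)) (suc m) ∷ʳ c ≡⟨ cong (_∷ʳ c) (normalExpr-setAt f m (suc c)) ⟩
    (nf ++ S) ∷ʳ c                                    ≡⟨ ++-assoc nf S [ c ] ⟩
    nf ++ S ∷ʳ c                                      ≡⟨ cong (nf ++_) (sigma-∷ʳ (s≤s c≤m)) ⟨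
    nf ++ sigma (suc m) c                             ∎)

insertion-merge : ∀ m {f} → NormalIndex m f → 1 ≤ k → k ≤ m →
                  Insertion (suc m) ((normalExpr f m ++ sigma (suc m) (suc k)) ∷ʳ k)
insertion-merge {k} m {f} f-normal 1≤k k≤m =
  normalises (setAt f (suc m) k) (NormalIndex-setAt f-normal 1≤k (m≤n⇒m≤1+n k≤m))
    (distLe-resp (sym word≡) refl (distLe-mono z≤n distLe-refl))
  where
  open ≡-Reasoning
  nf = normalExpr f m
  word≡ : (nf ++ sigma (suc m) (suc k)) ∷ʳ k ≡ normalExpr (setAt f (suc m) k) (suc m)
  word≡ = begin
    (nf ++ sigma (suc m) (suc k)) ∷ʳ k     ≡⟨ ++-assoc nf _ [ k ] ⟩
    nf ++ sigma (suc m) (suc k) ∷ʳ k       ≡⟨ cong (nf ++_) (sigma-∷ʳ (s≤s k≤m)) ⟨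
    nf ++ sigma (suc m) k                  ≡⟨ normalExpr-setAt f m k ⟨
    normalExpr (setAt f (suc m) k) (suc m) ∎

insert : ∀ m {f} k → NormalIndex m f → 1 ≤ k → k < m → Insertion m (normalExpr f m ∷ʳ k)
insert zero    _       _ _  ()
insert (suc m) zero    _ () _
insert (suc m) {f} (suc k) f-normal _ (s≤s 1+k≤m) =
  intoBlock (f (suc m)) (f-normal (suc m) (s≤s z≤n) ≤-refl)
  where
  f-normalₘ = NormalIndex-pred f-normal
  intoBlock : ∀ c → 1 ≤ c × c ≤ suc m →
              Insertion (suc m) ((normalExpr f m ++ sigma (suc m) c) ∷ʳ suc k)
  intoBlock c (1≤c , c≤1+m) with <-cmp c (suc k)
  ... | tri< (s≤s c≤k) _ _ =
    insertion-slide 1≤c c≤1+m (sigma-slide-braid c≤k (s≤s 1+k≤m))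
      (insert m k f-normalₘ (≤-trans 1≤c c≤k) 1+k≤m)
  ... | tri≈ _ refl _ = insertion-cancel m f-normalₘ 1≤c 1+k≤m
  ... | tri> _ _ 1+k<c with c ≟ suc (suc k)
  ...   | yes refl = insertion-merge m f-normalₘ (s≤s z≤n) 1+k≤m
  ...   | no c≢2+k =
    insertion-slide 1≤c c≤1+m (sigma-slide-far 3+k≤c)
      (insert m (suc k) f-normalₘ (s≤s z≤n) (≤-pred (≤-trans 3+k≤c c≤1+m)))
    where 3+k≤c = ≤∧≢⇒< 1+k<c (≢-sym c≢2+k)

reduced-++⁻ˡ : ∀ u w → Reduced n (u ++ w) → Reduced n u
reduced-++⁻ˡ {n} u w (u++w-expr , u++w-minimal) = ++⁻ˡ u u++w-expr , u-minimal
  where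
  u-minimal : ∀ v → IsExpr n v → Equiv u v → length u ≤ length v
  u-minimal v v-expr u≈v = +-cancelʳ-≤ (length w) _ _
    (subst₂ _≤_ (length-++ u) (length-++ v)
      (u++w-minimal (v ++ w) (++⁺ v-expr (++⁻ʳ u u++w-expr)) (equiv-++ʳ {u} {v} w u≈v)))

NormalWithin : ℕ → Word → ℕ → Set
NormalWithin n u d = ∃[ g ] (NormalIndex n g × DistLe u (normalExpr g n) d)

normalWithin-mono : a ≤ b → NormalWithin n u a → NormalWithin n u b
normalWithin-mono a≤b (g , g-normal , u~g) = g , g-normal , distLe-mono a≤b u~g

normalWithin-∷ʳ : Reduced n (u ∷ʳ k) → NormalWithin n u d → NormalWithin n (u ∷ʳ k) (d + n C 2)
normalWithin-∷ʳ {n} {u} {k} (u∷ʳk-expr , u∷ʳk-minimal) (g , g-normal , u~g)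
  with ++⁻ʳ u u∷ʳk-expr
... | (1≤k , k<n) ∷ [] with insert n k g-normal 1≤k k<n
...   | normalises g′ g′-normal g∷ʳk~g′ =
  g′ , g′-normal , distLe-trans (distLe-++ʳ [ k ] u~g) g∷ʳk~g′
...   | shortens g′ g′-normal g∷ʳk≈g′ shorter = contradiction too-short (≤⇒≯ minimal)
  where
  u∷ʳk~g∷ʳk = distLe-++ʳ [ k ] u~g
  too-short : length (normalExpr g′ n) < length (u ∷ʳ k)
  too-short = ≤-trans shorter (≤-reflexive (sym (distLe-length u∷ʳk~g∷ʳk)))
  minimal : length (u ∷ʳ k) ≤ length (normalExpr g′ n)
  minimal = u∷ʳk-minimal (normalExpr g′ n) (normalExpr-isExpr g′-normal ≤-refl)
              (λ x → trans (distLe-sound u∷ʳk~g∷ʳk x) (g∷ʳk≈g′ x))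

reduced⇒normalWithin : ∀ n u → Reverse u → Reduced n u → NormalWithin n u ((n C 2) * length u)
reduced⇒normalWithin n .[] [] _ =
  id , NormalIndex-id n , distLe-mono z≤n (distLe-resp refl (sym (normalExpr-id n)) distLe-refl)
reduced⇒normalWithin n .(u ∷ʳ k) (u ∶ u-view ∶ʳ k) u∷ʳk-reduced =
  normalWithin-mono (≤-reflexive bound≡)
    (normalWithin-∷ʳ u∷ʳk-reduced
      (reduced⇒normalWithin n u u-view (reduced-++⁻ˡ u [ k ] u∷ʳk-reduced)))
  where
  open ≡-Reasoning
  bound≡ : (n C 2) * length u + n C 2 ≡ (n C 2) * length (u ∷ʳ k)
  bound≡ = begin
    (n C 2) * length u + n C 2   ≡⟨ +-comm ((n C 2) * length u) (n C 2) ⟩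
    n C 2 + (n C 2) * length u   ≡⟨ *-suc (n C 2) (length u) ⟨
    (n C 2) * suc (length u)     ≡⟨ cong ((n C 2) *_) (length-∷ʳ u k) ⟨
    (n C 2) * length (u ∷ʳ k)    ∎

lemma1p4 : ∀ (n : ℕ) (u : Word) → Reduced n u →
           ∃[ f ] (NormalIndex n f × Equiv u (normalExpr f n) ×
                   DistLe u (normalExpr f n) ((n * (n ∸ 1) * length u) / 2))
lemma1p4 n u u-reduced =
  let f , f-normal , u~f = normalWithin-mono (≤-reflexive bound≡)
                              (reduced⇒normalWithin n u (reverseView u) u-reduced)
  in  f , f-normal , distLe-sound u~f , u~f
  where
  open ≡-Reasoning
  L = length u
  bound≡ : (n C 2) * L ≡ (n * (n ∸ 1) * L) / 2
  bound≡ = begin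
    (n C 2) * L              ≡⟨ m*n/n≡m ((n C 2) * L) 2 ⟨
    ((n C 2) * L * 2) / 2    ≡⟨ cong (_/ 2) (*-assoc (n C 2) L 2) ⟩
    ((n C 2) * (L * 2)) / 2  ≡⟨ cong (λ x → ((n C 2) * x) / 2) (*-comm L 2) ⟩
    ((n C 2) * (2 * L)) / 2  ≡⟨ cong (_/ 2) (*-assoc (n C 2) 2 L) ⟨
    ((n C 2) * 2 * L) / 2    ≡⟨ cong (λ x → (x * L) / 2) (nC2*2≡n*[n∸1] n) ⟩
    (n * (n ∸ 1) * L) / 2    ∎
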